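{- The map $\phi$ defined by $\phi\big((i_\square,j_\square)\big)=(i_\bullet,j_\circ)$ for $0\le i<j\le n+1$ is a bijection between the segments joining two vertices of $P^\square_\varepsilon$ (diagonals and boundary edges) and the edges of $G_\varepsilon$, and it induces a bijection between the dissections (resp. triangulations) of $P^\square_\varepsilon$ and the $\varepsilon$-forests (resp. $\varepsilon$-trees). In particular, the $\varepsilon$-complex is a simplicial associahedron, i.e. it is isomorphic to the simplicial complex of dissections of the $(n+2)$-gon $P^\square_\varepsilon$.
   Context: Fix an integer $n\ge 1$ and $\varepsilon\in\{+,-\}^n$. Let $P^\square_\varepsilon$ be a convex $(n+2)$-gon with vertices $0_\square,\dots,(n+1)_\square$ in strictly increasing $x$-order, with $k_\square$ strictly above the segment $[0_\square,(n+1)_\square]$ if $\varepsilon_k=+$ and strictly below it if $\varepsilon_k=-$ ($1\le k\le n$). A dissection of $P^\square_\varepsilon$ is a set of pairwise non-crossing segments $(i_\square,j_\square)$, $0\le i<j\le n+1$ (boundary edges allowed; two segments cross if they meet at a point interior to both), and a triangulation is an inclusion-maximal dissection. Black vertices are $0_\bullet,\dots,n_\bullet$, white vertices $1_\circ,\dots,(n+1)_\circ$. Let $P_\varepsilon$ be a convex $(2n+2)$-gon whose vertices, in strictly increasing $x$-order, are $0_\bullet,1_\circ,1_\bullet,\dots,n_\circ,n_\bullet,(n+1)_\circ$, with $k_\circ,k_\bullet$ strictly above the line through $0_\bullet$ and $(n+1)_\circ$ if $\varepsilon_k=+$ and strictly below if $\varepsilon_k=-$. Let $G_\varepsilon$ be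 the geometric graph on all these $2n+2$ vertices with a straight edge $(i_\bullet,j_\circ)$ whenever $i<j$. An $\varepsilon$-forest is a set of pairwise non-crossing edges of $G_\varepsilon$, an $\varepsilon$-tree is an inclusion-maximal $\varepsilon$-forest, and the $\varepsilon$-complex is the simplicial complex on the edges of $G_\varepsilon$ whose faces are the $\varepsilon$-forests. -}

module Defs where

open import Data.Nat using (ℕ; zero; suc; _+_; _*_; _∸_; _<_; _<?_)
open import Data.Nat.Base using (_⊓_; _⊔_)
open import Data.Fin using (Fin; toℕ; fromℕ<)
open import Data.Bool using (Bool; true; false; if_then_else_)
open import Data.Product using (Σ; _×_; _,_)
open import Data.Sum using (_⊎_)
open import Relation.Nullary using (¬_; yes; no)
open import Relation.Binary.PropositionalEquality using (_≡_)

data Sign : Set where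
  plus minus : Sign

isPlus : Sign → Bool
isPlus plus  = true
isPlus minus = false

-- ε : Fin n → Sign, where ε k is the paper's ε_{k+1} (1 ≤ k+1 ≤ n).
-- upper ε k : whether the vertex with label k ∈ {0,…,n+1} lies on the upper
-- chain of the convex polygon.  The extreme labels 0 and n+1 lie on both
-- chains; we put them on the upper one.
upper : ∀ {n} → (Fin n → Sign) → ℕ → Bool
upper ε zero = true
upper {n} ε (suc k) with k <? n
... | yes p = isPlus (ε (fromℕ< p))
... | no _  = true

-- Position in the cyclic (counterclockwise-reversed) boundary order of a
-- convex polygon whose vertices have x-ranks 0..M: upper vertices in
-- increasing x-order, then lower vertices in decreasing x-order.
cycPos : Bool → ℕ → ℕ → ℕ
cycPos up M r = if up then r else (2 * M) ∸ r

Between : ℕ → ℕ → ℕ → Set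
Between a b c = (a ⊓ b) < c × c < (a ⊔ b)

Outside : ℕ → ℕ → ℕ → Set
Outside a b c = c < (a ⊓ b) ⊎ (a ⊔ b) < c

-- Two chords {a,b}, {c,d} of a convex polygon (positions in cyclic order)
-- cross (meet at a point interior to both) iff their endpoints interleave.
ChordsCross : ℕ → ℕ → ℕ → ℕ → Set
ChordsCross a b c d = (Between a b c × Outside a b d) ⊎ (Outside a b c × Between a b d)

-- The polygon P^□_ε : vertices 0_□,…,(n+1)_□, x-rank of k_□ is k.

record Seg (n : ℕ) : Set where
  constructor seg
  field
    i j : Fin (suc (suc n))
    i<j : toℕ i < toℕ j

posSq : ∀ {n} → (Fin n → Sign) → ℕ → ℕ
posSq {n} ε k = cycPos (upper ε k) (suc n) k

SegCross : ∀ {n} → (Fin n → Sign) → Seg n → Seg n → Set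
SegCross ε (seg i j _) (seg k l _) =
  ChordsCross (posSq ε (toℕ i)) (posSq ε (toℕ j)) (posSq ε (toℕ k)) (posSq ε (toℕ l))

Dissection : ∀ {n} → (Fin n → Sign) → (Seg n → Set) → Set
Dissection ε S = ∀ s t → S s → S t → ¬ SegCross ε s t

Triangulation : ∀ {n} → (Fin n → Sign) → (Seg n → Set) → Set₁
Triangulation {n} ε S =
  Dissection ε S ×
  (∀ (T : Seg n → Set) → Dissection ε T → (∀ s → S s → T s) → ∀ s → T s → S s)

-- The polygon P_ε : vertices 0_•,1_∘,1_•,…,n_∘,n_•,(n+1)_∘ in x-order,
-- so the x-rank of i_• is 2i and that of j_∘ is 2j-1 (ranks 0..2n+1).
-- k_• and k_∘ are on the side given by ε_k.

record Edge (n : ℕ) : Set where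
  constructor edge
  field
    i j : Fin (suc (suc n))
    i<j : toℕ i < toℕ j

posBlack : ∀ {n} → (Fin n → Sign) → ℕ → ℕ
posBlack {n} ε i = cycPos (upper ε i) (suc (2 * n)) (2 * i)

posWhite : ∀ {n} → (Fin n → Sign) → ℕ → ℕ
posWhite {n} ε j = cycPos (upper ε j) (suc (2 * n)) (2 * j ∸ 1)

EdgeCross : ∀ {n} → (Fin n → Sign) → Edge n → Edge n → Set
EdgeCross ε (edge i j _) (edge k l _) =
  ChordsCross (posBlack ε (toℕ i)) (posWhite ε (toℕ j)) (posBlack ε (toℕ k)) (posWhite ε (toℕ l))

Forest : ∀ {n} → (Fin n → Sign) → (Edge n → Set) → Set
Forest ε F = ∀ e f → F e → F f → ¬ EdgeCross ε e f

Tree : ∀ {n} → (Fin n → Sign) → (Edge n → Set) → Set₁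
Tree {n} ε F =
  Forest ε F ×
  (∀ (H : Edge n → Set) → Forest ε H → (∀ e → F e → H e) → ∀ e → H e → F e)

φ : ∀ {n} → Seg n → Edge n
φ (seg i j p) = edge i j p

Image : ∀ {n} → (Seg n → Set) → Edge n → Set
Image {n} S e = Σ (Seg n) (λ s → S s × φ s ≡ e)

-- Both polygons are convex, so whether two segments cross depends only on the
-- boundary order of their four endpoints, and that order is determined by the
-- side and the x-rank of each vertex.  Sending u_□ to u_• or to u_∘ keeps the
-- side and preserves the x-order of distinct labels, so φ preserves crossings
-- and reflects them, except possibly for two edges (i_•, u_∘) and (u_•, l_∘)
-- through the two copies of one label u.  These never cross: u_∘ and u_• are
-- consecutive on the same side and i_• < u_∘ < u_• < l_∘, exactly as the
-- segments (i_□, u_□) and (u_□, l_□) sharing an endpoint do not cross.  A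
-- crossing-preserving bijection then matches non-crossing families, and
-- maximal ones, on both sides.
module Submission where

open import Defs
open import Data.Bool using (Bool; true; false)
open import Data.Empty using (⊥; ⊥-elim)
open import Data.Fin using (Fin; toℕ)
open import Data.Fin.Properties using (toℕ<n)
open import Data.Nat using (ℕ; zero; suc; _+_; _*_; _∸_; _<_; _≤_; _<?_; _≟_; z≤n; s≤s; z<s; s<s)
open import Data.Nat.Properties
open import Data.Product using (Σ; _×_; _,_; uncurry)
import Data.Product as Prod
open import Data.Sum using (_⊎_; inj₁; inj₂; [_,_])
import Data.Sum as Sum
open import Data.Unit using (⊤; tt)
open import Function using (_∘_; const)
open import Function.Bundles using (_⇔_; mk⇔; Equivalence)
open import Function.Definitions using (Bijective; Injective; Surjective)
open import Relation.Binary.Definitions using (Asymmetric; Decidable; tri<; tri≈; tri>)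
open import Relation.Binary.PropositionalEquality using (_≡_; _≢_; refl; sym; cong; subst; ≢-sym)
open import Relation.Nullary using (¬_; Dec; yes; no)
open import Relation.Nullary.Decidable using (_×-dec_; _⊎-dec_; False; toWitnessFalse; map′)

open Equivalence using (to; from)

module _ {A : Set} (R : A → A → Set) where

  Within : A → A → A → Set
  Within a b c = (R a c ⊎ R b c) × (R c a ⊎ R c b)

  Beyond : A → A → A → Set
  Beyond a b c = (R c a × R c b) ⊎ (R a c × R b c)

  data Interleaved (a b c d : A) : Set where
    c-within : Within a b c → Beyond a b d → Interleaved a b c d
    d-within : Beyond a b c → Within a b d → Interleaved a b c d

  interleaved? : Decidable R → ∀ a b c d → Dec (Interleaved a b c d)
  interleaved? _R?_ a b c d =
    map′ [ uncurry c-within , uncurry d-within ] split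
         ((within? c ×-dec beyond? d) ⊎-dec (beyond? c ×-dec within? d))
    where
    split : Interleaved a b c d → (Within a b c × Beyond a b d) ⊎ (Beyond a b c × Within a b d)
    split (c-within x y) = inj₁ (x , y)
    split (d-within x y) = inj₂ (x , y)
    within? : ∀ x → Dec (Within a b x)
    within? x = (a R? x ⊎-dec b R? x) ×-dec (x R? a ⊎-dec x R? b)
    beyond? : ∀ x → Dec (Beyond a b x)
    beyond? x = (x R? a ×-dec x R? b) ⊎-dec (a R? x ×-dec b R? x)

data Carries {A B : Set} (R : A → A → Set) (R′ : B → B → Set) (x y : A) (x′ y′ : B) : Set where
  carries : (R x y → R′ x′ y′) → (R y x → R′ y′ x′) → Carries R R′ x y x′ y′

module _ {A B : Set} {R : A → A → Set} {R′ : B → B → Set} where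

  Within-transfer : ∀ {a b c a′ b′ c′} → Carries R R′ a c a′ c′ → Carries R R′ b c b′ c′ →
                    Within R a b c → Within R′ a′ b′ c′
  Within-transfer (carries ac ca) (carries bc cb) = Prod.map (Sum.map ac bc) (Sum.map ca cb)

  Beyond-transfer : ∀ {a b c a′ b′ c′} → Carries R R′ a c a′ c′ → Carries R R′ b c b′ c′ →
                    Beyond R a b c → Beyond R′ a′ b′ c′
  Beyond-transfer (carries ac ca) (carries bc cb) = Sum.map (Prod.map ca cb) (Prod.map ac bc)

  Interleaved-transfer : ∀ {a b c d a′ b′ c′ d′} →
    Carries R R′ a c a′ c′ → Carries R R′ b c b′ c′ →
    Carries R R′ a d a′ d′ → Carries R R′ b d b′ d′ →
    Interleaved R a b c d → Interleaved R′ a′ b′ c′ d′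
  Interleaved-transfer ac bc ad bd (c-within x y) =
    c-within (Within-transfer ac bc x) (Beyond-transfer ad bd y)
  Interleaved-transfer ac bc ad bd (d-within x y) =
    d-within (Beyond-transfer ac bc x) (Within-transfer ad bd y)

Interleaved-swap : {A : Set} {R : A → A → Set} → Asymmetric R →
                   ∀ {a b c d} → Interleaved R a b c d → Interleaved R c d a b
Interleaved-swap asym (c-within (inj₁ ac , inj₁ ca) _) = ⊥-elim (asym ac ca)
Interleaved-swap asym (c-within (inj₂ bc , inj₂ cb) _) = ⊥-elim (asym bc cb)
Interleaved-swap _ (c-within (inj₁ ac , inj₂ cb) (inj₁ (da , db))) = c-within (inj₂ da , inj₁ ac) (inj₂ (cb , db))
Interleaved-swap _ (c-within (inj₁ ac , inj₂ cb) (inj₂ (ad , bd))) = d-within (inj₁ (ac , ad)) (inj₁ cb , inj₂ bd)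
Interleaved-swap _ (c-within (inj₂ bc , inj₁ ca) (inj₁ (da , db))) = d-within (inj₂ (ca , da)) (inj₂ db , inj₁ bc)
Interleaved-swap _ (c-within (inj₂ bc , inj₁ ca) (inj₂ (ad , bd))) = c-within (inj₁ ca , inj₂ ad) (inj₁ (bc , bd))
Interleaved-swap asym (d-within _ (inj₁ ad , inj₁ da)) = ⊥-elim (asym ad da)
Interleaved-swap asym (d-within _ (inj₂ bd , inj₂ db)) = ⊥-elim (asym bd db)
Interleaved-swap _ (d-within (inj₁ (ca , cb)) (inj₁ ad , inj₂ db)) = c-within (inj₁ ca , inj₂ ad) (inj₂ (cb , db))
Interleaved-swap _ (d-within (inj₁ (ca , cb)) (inj₂ bd , inj₁ da)) = d-within (inj₂ (ca , da)) (inj₁ cb , inj₂ bd)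
Interleaved-swap _ (d-within (inj₂ (ac , bc)) (inj₁ ad , inj₂ db)) = d-within (inj₁ (ac , ad)) (inj₂ db , inj₁ bc)
Interleaved-swap _ (d-within (inj₂ (ac , bc)) (inj₂ bd , inj₁ da)) = c-within (inj₂ da , inj₁ ac) (inj₁ (bc , bd))

Between⇔Within : ∀ a b c → Between a b c ⇔ Within _<_ a b c
Between⇔Within a b c = mk⇔
  (Prod.map (λ h → Sum.map (λ e → subst (_< c) e h) (λ e → subst (_< c) e h) (⊓-sel a b))
            (λ h → Sum.map (λ e → subst (c <_) e h) (λ e → subst (c <_) e h) (⊔-sel a b)))
  (Prod.map [ m<n⇒m⊓o<n b , m<n⇒o⊓m<n a ] [ m<n⇒m<n⊔o b , m<n⇒m<o⊔n a ])

Outside⇔Beyond : ∀ a b c → Outside a b c ⇔ Beyond _<_ a b c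
Outside⇔Beyond a b c = mk⇔
  (Sum.map (λ h → m<n⊓o⇒m<n a b h , m<n⊓o⇒m<o a b h) (λ h → m⊔n<o⇒m<o a b h , m⊔n<o⇒n<o a b h))
  (Sum.map (uncurry ⊓-pres-m<) (uncurry ⊔-pres-<m))

ChordsCross⇔Interleaved : ∀ a b c d → ChordsCross a b c d ⇔ Interleaved _<_ a b c d
ChordsCross⇔Interleaved a b c d = mk⇔
  [ uncurry (λ x y → c-within (to (Between⇔Within a b c) x) (to (Outside⇔Beyond a b d) y))
  , uncurry (λ x y → d-within (to (Outside⇔Beyond a b c) x) (to (Between⇔Within a b d) y)) ]
  λ { (c-within x y) → inj₁ (from (Between⇔Within a b c) x , from (Outside⇔Beyond a b d) y)
    ; (d-within x y) → inj₂ (from (Outside⇔Beyond a b c) x , from (Between⇔Within a b d) y) }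

-- Vertices are keyed by (on the upper chain?, x-rank); _≺_ is the boundary
-- order that cycPos numbers: along the upper chain from left to right, then
-- back along the lower chain.
_≺_ : Bool × ℕ → Bool × ℕ → Set
(true  , r) ≺ (true  , r′) = r < r′
(true  , _) ≺ (false , _)  = ⊤
(false , _) ≺ (true  , _)  = ⊥
(false , r) ≺ (false , r′) = r′ < r

_≺?_ : Decidable _≺_
(true  , r) ≺? (true  , r′) = r <? r′
(true  , _) ≺? (false , _)  = yes tt
(false , _) ≺? (true  , _)  = no λ ()
(false , r) ≺? (false , r′) = r′ <? r

≺-asym : Asymmetric _≺_
≺-asym {true  , _} {true  , _} = <-asym
≺-asym {true  , _} {false , _} _ ()
≺-asym {false , _} {true  , _} ()
≺-asym {false , _} {false , _} = <-asym

≺-relabel : ∀ {s s′ r r′ t t′} → (r < r′ → t < t′) → (r′ < r → t′ < t) →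
            Carries _≺_ _≺_ (s , r) (s′ , r′) (s , t) (s′ , t′)
≺-relabel {s} {s′} f g = carries (relabel s s′ f g) (relabel s′ s g f)
  where
  relabel : ∀ s s′ {r r′ t t′} → (r < r′ → t < t′) → (r′ < r → t′ < t) →
            (s , r) ≺ (s′ , r′) → (s , t) ≺ (s′ , t′)
  relabel true  true  f _ = f
  relabel true  false _ _ = const tt
  relabel false true  _ _ = λ ()
  relabel false false _ g = g

≺-relabel-< : ∀ {s s′ r r′ t t′} → r < r′ → t < t′ →
              Carries _≺_ _≺_ (s , r) (s′ , r′) (s , t) (s′ , t′)
≺-relabel-< r<r′ t<t′ = ≺-relabel (const t<t′) (⊥-elim ∘ <-asym r<r′)

data OnBoundary (M : ℕ) : Bool × ℕ → Set where
  upperChain : ∀ {r} → r ≤ M → OnBoundary M (true , r)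
  lowerChain : ∀ {r} → r < M → OnBoundary M (false , r)

onBoundary : ∀ {M} s {r} → r ≤ M → (s ≡ false → r < M) → OnBoundary M (s , r)
onBoundary true  r≤M _    = upperChain r≤M
onBoundary false _   r<M = lowerChain (r<M refl)

keyPos : ℕ → Bool × ℕ → ℕ
keyPos M (s , r) = cycPos s M r

M<2M∸r : ∀ {M r} → r < M → M < 2 * M ∸ r
M<2M∸r {M} {r} r<M = subst (_< 2 * M ∸ r) (m+n∸n≡m M r)
  (∸-monoˡ-< (subst (M + r <_) (cong (M +_) (sym (+-identityʳ M))) (+-monoʳ-< M r<M)) (m≤n+m r M))

≺⇒keyPos< : ∀ {M x y} → OnBoundary M x → OnBoundary M y → x ≺ y → keyPos M x < keyPos M y
≺⇒keyPos< (upperChain _)   (upperChain _)   r<r′ = r<r′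
≺⇒keyPos< (upperChain r≤M) (lowerChain r′<M) _   = ≤-<-trans r≤M (M<2M∸r r′<M)
≺⇒keyPos< (lowerChain _)   (upperChain _)   ()
≺⇒keyPos< {M} (lowerChain r<M) (lowerChain _) r′<r =
  ∸-monoʳ-< r′<r (≤-trans (<⇒≤ r<M) (m≤n*m M 2))

keyPos<⇒≺ : ∀ {M x y} → OnBoundary M x → OnBoundary M y → keyPos M x < keyPos M y → x ≺ y
keyPos<⇒≺ (upperChain _)   (upperChain _)    h = h
keyPos<⇒≺ (upperChain _)   (lowerChain _)    _ = tt
keyPos<⇒≺ (lowerChain r<M) (upperChain r′≤M) h = <⇒≱ (<-trans (M<2M∸r r<M) h) r′≤M
keyPos<⇒≺ (lowerChain _)   (lowerChain _)    h = ∸-cancelʳ-< h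

ChordsCross⇔Interleaved≺ : ∀ {M a b c d} →
  OnBoundary M a → OnBoundary M b → OnBoundary M c → OnBoundary M d →
  ChordsCross (keyPos M a) (keyPos M b) (keyPos M c) (keyPos M d) ⇔ Interleaved _≺_ a b c d
ChordsCross⇔Interleaved≺ {M} {a} {b} {c} {d} ba bb bc bd = mk⇔
  (Interleaved-transfer (reflects ba bc) (reflects bb bc) (reflects ba bd) (reflects bb bd)
    ∘ to (ChordsCross⇔Interleaved _ _ _ _))
  (from (ChordsCross⇔Interleaved _ _ _ _)
    ∘ Interleaved-transfer (preserves ba bc) (preserves bb bc) (preserves ba bd) (preserves bb bd))
  where
  preserves : ∀ {x y} → OnBoundary M x → OnBoundary M y →
              Carries _≺_ _<_ x y (keyPos M x) (keyPos M y)
  preserves bx by = carries (≺⇒keyPos< bx by) (≺⇒keyPos< by bx)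
  reflects : ∀ {x y} → OnBoundary M x → OnBoundary M y →
             Carries _<_ _≺_ (keyPos M x) (keyPos M y) x y
  reflects bx by = carries (keyPos<⇒≺ bx by) (keyPos<⇒≺ by bx)

data Colour : Set where
  black white : Colour

rank : Colour → ℕ → ℕ
rank black u = 2 * u
rank white u = 2 * u ∸ 1

rank≤2* : ∀ c u → rank c u ≤ 2 * u
rank≤2* black u = ≤-refl
rank≤2* white u = m∸n≤m (2 * u) 1

2*∸1≤rank : ∀ c u → 2 * u ∸ 1 ≤ rank c u
2*∸1≤rank black u = m∸n≤m (2 * u) 1
2*∸1≤rank white u = ≤-refl

rank-mono : ∀ c c′ {u v} → u < v → rank c u < rank c′ v
rank-mono c c′ {u} {v} u<v = ≤-<-trans (rank≤2* c u) (<-≤-trans 2u<2v∸1 (2*∸1≤rank c′ v))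
  where
  2u<2v∸1 : 2 * u < 2 * v ∸ 1
  2u<2v∸1 = ∸-monoˡ-≤ 1 (subst (_≤ 2 * v) (*-suc 2 u) (*-monoʳ-≤ 2 u<v))

rank-white<black : ∀ {u} → 0 < u → rank white u < rank black u
rank-white<black {suc u} _ = ≤-refl

rank-reflects : ∀ {c c′ u v} → u ≢ v ⊎ c ≡ c′ → rank c u < rank c′ v → u < v
rank-reflects {c} {c′} {u} {v} distinct h with <-cmp u v
... | tri< u<v _ _ = u<v
... | tri> _ _ v<u = ⊥-elim (<-asym h (rank-mono c′ c v<u))
rank-reflects (inj₁ u≢u) h | tri≈ _ refl _ = ⊥-elim (u≢u refl)
rank-reflects (inj₂ refl) h | tri≈ _ refl _ = ⊥-elim (<-irrefl refl h)

rank<1+2* : ∀ c {u n} → u ≤ n → rank c u < suc (2 * n)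
rank<1+2* c {u} u≤n = s≤s (≤-trans (rank≤2* c u) (*-monoʳ-≤ 2 u≤n))

rank-white≤1+2* : ∀ {u n} → u ≤ suc n → rank white u ≤ suc (2 * n)
rank-white≤1+2* {u} {n} u≤1+n =
  subst (2 * u ∸ 1 ≤_) (+-suc n (n + 0)) (∸-monoˡ-≤ 1 (*-monoʳ-≤ 2 u≤1+n))

module _ {n : ℕ} (ε : Fin n → Sign) where

  upper≡false⇒≤ : ∀ u → upper ε u ≡ false → u ≤ n
  upper≡false⇒≤ zero    ()
  upper≡false⇒≤ (suc u) lower with u <? n
  ... | yes u<n = u<n
  upper≡false⇒≤ (suc u) () | no _

  labelKey : ℕ → Bool × ℕ
  labelKey u = upper ε u , u

  vertexKey : Colour → ℕ → Bool × ℕ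
  vertexKey c u = upper ε u , rank c u

  labelKey-onBoundary : (u : Fin (suc (suc n))) → OnBoundary (suc n) (labelKey (toℕ u))
  labelKey-onBoundary u =
    onBoundary (upper ε (toℕ u)) (≤-pred (toℕ<n u)) (s≤s ∘ upper≡false⇒≤ (toℕ u))

  blackKey-onBoundary : ∀ {i} (j : Fin (suc (suc n))) → i < toℕ j →
                        OnBoundary (suc (2 * n)) (vertexKey black i)
  blackKey-onBoundary {i} j i<j = onBoundary (upper ε i) (<⇒≤ rank<) (const rank<)
    where
    rank< : rank black i < suc (2 * n)
    rank< = rank<1+2* black (≤-pred (<-≤-trans i<j (≤-pred (toℕ<n j))))

  whiteKey-onBoundary : (j : Fin (suc (suc n))) → OnBoundary (suc (2 * n)) (vertexKey white (toℕ j))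
  whiteKey-onBoundary j = onBoundary (upper ε (toℕ j)) (rank-white≤1+2* (≤-pred (toℕ<n j)))
    (rank<1+2* white ∘ upper≡false⇒≤ (toℕ j))

  SegCross⇔Interleaved : ∀ i j k l p q → SegCross ε (seg i j p) (seg k l q) ⇔
    Interleaved _≺_ (labelKey (toℕ i)) (labelKey (toℕ j)) (labelKey (toℕ k)) (labelKey (toℕ l))
  SegCross⇔Interleaved i j k l _ _ = ChordsCross⇔Interleaved≺
    (labelKey-onBoundary i) (labelKey-onBoundary j) (labelKey-onBoundary k) (labelKey-onBoundary l)

  EdgeCross⇔Interleaved : ∀ i j k l p q → EdgeCross ε (edge i j p) (edge k l q) ⇔
    Interleaved _≺_ (vertexKey black (toℕ i)) (vertexKey white (toℕ j))
                    (vertexKey black (toℕ k)) (vertexKey white (toℕ l))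
  EdgeCross⇔Interleaved i j k l p q = ChordsCross⇔Interleaved≺
    (blackKey-onBoundary j p) (whiteKey-onBoundary j) (blackKey-onBoundary l q) (whiteKey-onBoundary l)

  labelKey→vertexKey : ∀ c c′ {u v} →
    Carries _≺_ _≺_ (labelKey u) (labelKey v) (vertexKey c u) (vertexKey c′ v)
  labelKey→vertexKey c c′ = ≺-relabel (rank-mono c c′) (rank-mono c′ c)

  vertexKey→labelKey : ∀ c c′ {u v} → u ≢ v ⊎ c ≡ c′ →
    Carries _≺_ _≺_ (vertexKey c u) (vertexKey c′ v) (labelKey u) (labelKey v)
  vertexKey→labelKey _ _ distinct =
    ≺-relabel (rank-reflects distinct) (rank-reflects (Sum.map ≢-sym sym distinct))

  -- Crossing of keys only depends on their sides and on the relative order of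
  -- their ranks, so it suffices to decide the case of ranks 0, 1, 2, 3.
  shared-endpoint-noncrossing : ∀ {i j k l} → i < j → j ≡ k → k < l →
    ¬ Interleaved _≺_ (vertexKey black i) (vertexKey white j) (vertexKey black k) (vertexKey white l)
  shared-endpoint-noncrossing {i} {j} {_} {l} i<j refl j<l =
    toWitnessFalse (decided (upper ε i) (upper ε j) (upper ε l))
      ∘ Interleaved-transfer
          (≺-relabel-< (rank-mono black black i<j) z<s)
          (≺-relabel-< (rank-white<black (≤-<-trans z≤n i<j)) (s<s z<s))
          (≺-relabel-< (rank-mono black white (<-trans i<j j<l)) z<s)
          (≺-relabel-< (rank-mono white white j<l) (s<s z<s))
    where
    decided : ∀ s₁ s₂ s₄ →
      False (interleaved? _≺_ _≺?_ (s₁ , 0) (s₂ , 1) (s₂ , 2) (s₄ , 3))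
    decided true  true  true  = tt
    decided true  true  false = tt
    decided true  false true  = tt
    decided true  false false = tt
    decided false true  true  = tt
    decided false true  false = tt
    decided false false true  = tt
    decided false false false = tt

  SegCross⇔EdgeCross : ∀ s t → SegCross ε s t ⇔ EdgeCross ε (φ s) (φ t)
  SegCross⇔EdgeCross (seg i j p) (seg k l q) = mk⇔
    (from (EdgeCross⇔Interleaved i j k l p q)
      ∘ Interleaved-transfer (labelKey→vertexKey black black) (labelKey→vertexKey white black)
                             (labelKey→vertexKey black white) (labelKey→vertexKey white white)
      ∘ to (SegCross⇔Interleaved i j k l p q))
    (reflect ∘ to (EdgeCross⇔Interleaved i j k l p q))
    where
    bᵢ wⱼ bₖ wₗ : Bool × ℕ
    bᵢ = vertexKey black (toℕ i)
    wⱼ = vertexKey white (toℕ j)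
    bₖ = vertexKey black (toℕ k)
    wₗ = vertexKey white (toℕ l)
    reflect : Interleaved _≺_ bᵢ wⱼ bₖ wₗ → SegCross ε (seg i j p) (seg k l q)
    reflect h with toℕ j ≟ toℕ k | toℕ i ≟ toℕ l
    ... | yes j≡k | _       = ⊥-elim (shared-endpoint-noncrossing p j≡k q h)
    ... | no _    | yes i≡l = ⊥-elim (shared-endpoint-noncrossing q (sym i≡l) p
                                       (Interleaved-swap ≺-asym h))
    ... | no j≢k  | no i≢l  = from (SegCross⇔Interleaved i j k l p q)
      (Interleaved-transfer (vertexKey→labelKey black black (inj₂ refl))
                            (vertexKey→labelKey white black (inj₁ j≢k))
                            (vertexKey→labelKey black white (inj₁ i≢l))
                            (vertexKey→labelKey white white (inj₂ refl)) h)

NonCrossing : {A : Set} → (A → A → Set) → (A → Set) → Set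
NonCrossing Cross S = ∀ s t → S s → S t → ¬ Cross s t

MaximalNonCrossing : {A : Set} → (A → A → Set) → (A → Set) → Set₁
MaximalNonCrossing {A} Cross S =
  NonCrossing Cross S × (∀ (T : A → Set) → NonCrossing Cross T → (∀ s → S s → T s) → ∀ s → T s → S s)

image : {A B : Set} → (A → B) → (A → Set) → B → Set
image {A} f S b = Σ A λ a → S a × f a ≡ b

module _ {A B : Set} {CrossA : A → A → Set} {CrossB : B → B → Set}
         (f : A → B) (f-cross : ∀ s t → CrossA s t ⇔ CrossB (f s) (f t)) where

  NonCrossing-preimage : ∀ H → NonCrossing CrossB H → NonCrossing CrossA (H ∘ f)
  NonCrossing-preimage H nc s t Hs Ht = nc (f s) (f t) Hs Ht ∘ to (f-cross s t)

  NonCrossing-image : ∀ S → NonCrossing CrossA S ⇔ NonCrossing CrossB (image f S)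
  NonCrossing-image S = mk⇔
    (λ { nc _ _ (s , Ss , refl) (t , St , refl) → nc s t Ss St ∘ from (f-cross s t) })
    (λ nc s t Ss St → NonCrossing-preimage (image f S) nc s t (s , Ss , refl) (t , St , refl))

  MaximalNonCrossing-image : Bijective _≡_ _≡_ f →
    ∀ S → MaximalNonCrossing CrossA S ⇔ MaximalNonCrossing CrossB (image f S)
  MaximalNonCrossing-image (f-injective , f-surjective) S = mk⇔ push pull
    where
    preimage : ∀ b → Σ A λ a → f a ≡ b
    preimage b = Prod.map₂ (λ section → section refl) (f-surjective b)

    unimage : ∀ {a} → image f S (f a) → S a
    unimage (a′ , Sa′ , fa′≡fa) = subst S (f-injective fa′≡fa) Sa′

    push : MaximalNonCrossing CrossA S → MaximalNonCrossing CrossB (image f S)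
    push (nc , maximal) = to (NonCrossing-image S) nc , λ H ncH S⊆H b Hb →
      let (a , fa≡b) = preimage b
          Ha = subst H (sym fa≡b) Hb
      in a , maximal (H ∘ f) (NonCrossing-preimage H ncH) (λ s Ss → S⊆H (f s) (s , Ss , refl)) a Ha
           , fa≡b

    pull : MaximalNonCrossing CrossB (image f S) → MaximalNonCrossing CrossA S
    pull (nc , maximal) = from (NonCrossing-image S) nc , λ T ncT S⊆T a Ta →
      unimage (maximal (image f T) (to (NonCrossing-image T) ncT)
                       (λ { _ (s , Ss , refl) → s , S⊆T s Ss , refl }) (f a) (a , Ta , refl))

φ-injective : ∀ {n} → Injective _≡_ _≡_ (φ {n})
φ-injective {x = seg i j p} {seg .i .j .p} refl = refl

φ-surjective : ∀ {n} → Surjective _≡_ _≡_ (φ {n})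
φ-surjective (edge i j p) = seg i j p , λ { refl → refl }

φ-bijective : ∀ {n} → Bijective _≡_ _≡_ (φ {n})
φ-bijective = φ-injective , φ-surjective

proposition1p5 : (n : ℕ) → (ε : Fin n → Sign) →
    Bijective _≡_ _≡_ (φ {n}) ×
    (∀ (S : Seg n → Set) → Dissection ε S ⇔ Forest ε (Image S)) ×
    (∀ (S : Seg n → Set) → Triangulation ε S ⇔ Tree ε (Image S))
proposition1p5 n ε =
  φ-bijective ,
  NonCrossing-image φ (SegCross⇔EdgeCross ε) ,
  MaximalNonCrossing-image φ (SegCross⇔EdgeCross ε) φ-bijective
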